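{- Let $R$ be a region context and $M$ a closed term such that $R;\emptyset \vdash^{ef} M : A$ is derivable in the effect-free type system. Then exactly one of the following holds: (1) $M$ is a value; (2) $M = E[\Delta]$ for some evaluation context $E$, where $\Delta$ has one of the shapes $(\lambda x.N)V$, $\mathsf{set}(r,V)$, or $\mathsf{get}(r)$ (with $V$ a value and $r$ a region).
   Context: Syntax. Variables $x,y,\ldots$; regions $r,s,\ldots$. Terms: $M ::= x \mid r \mid * \mid \lambda x.M \mid MM \mid \mathsf{get}(M) \mid \mathsf{set}(M,M)$. Values: $V ::= r \mid * \mid \lambda x.M$. Evaluation contexts: $E ::= [\,] \mid EM \mid VE \mid \mathsf{get}(E) \mid \mathsf{set}(E,M) \mid \mathsf{set}(V,E)$; $E[N]$ is the result of filling the hole with $N$. Effect-free type system. Types: $A ::= \mathbf{1} \mid \mathrm{Reg}_r A \mid A \to A$. A region context is $R = r_1:A_1,\ldots,r_n:A_n$ (distinct regions), a context is $\Gamma = x_1:A_1,\ldots,x_n:A_n$. Well-formedness: $R \Vdash \mathbf{1}$; if $R\Vdash A$ and $R\Vdash B$ then $R \Vdash A\to B$; if $r:A\in R$ then $R\Vdash \mathrm{Reg}_rA$; $R\vdash$ holds iff $R \Vdash R(r)$ for all $r$ in the domain of $R$; $R\vdash A$ iff $R\vdash$ and $R\Vdash A$; $R\vdash \Gamma$ iff $R\vdash$ and $R\vdash A_i$ for all $x_i:A_i\in\Gamma$. Typing rules for $R;\Gamma\vdash^{ef} M:A$: if $R\vdash\Gamma$ and $x:A\in\Gamma$ then $R;\Gamma\vdash^{ef}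 x:A$; if $R\vdash\Gamma$ and $r:A\in R$ then $R;\Gamma\vdash^{ef} r:\mathrm{Reg}_rA$; if $R\vdash\Gamma$ then $R;\Gamma\vdash^{ef} *:\mathbf{1}$; from $R;\Gamma,x:A\vdash^{ef} M:B$ infer $R;\Gamma\vdash^{ef}\lambda x.M:A\to B$; from $R;\Gamma\vdash^{ef} M:A\to B$ and $R;\Gamma\vdash^{ef} N:A$ infer $R;\Gamma\vdash^{ef} MN:B$; from $R;\Gamma\vdash^{ef} M:\mathrm{Reg}_rA$ infer $R;\Gamma\vdash^{ef}\mathsf{get}(M):A$; from $R;\Gamma\vdash^{ef} M:\mathrm{Reg}_rA$ and $R;\Gamma\vdash^{ef} N:A$ infer $R;\Gamma\vdash^{ef}\mathsf{set}(M,N):\mathbf{1}$. (This is the type-and-effect system of the paper with all effect annotations erased.) -}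

module Defs where

open import Data.Nat using (ℕ)
open import Data.Product using (_×_; _,_; proj₁; proj₂; Σ)
open import Data.Sum using (_⊎_)
open import Data.List using (List; []; _∷_; map)
open import Data.List.Membership.Propositional using (_∈_)
open import Data.List.Relation.Unary.All using (All)
open import Data.List.Relation.Unary.Unique.Propositional using (Unique)
open import Relation.Binary.PropositionalEquality using (_≡_; _≢_)
open import Relation.Nullary using (¬_)

Var : Set
Var = ℕ

Region : Set
Region = ℕ

data Term : Set where
  var  : Var → Term
  reg  : Region → Term
  unit : Term
  lam  : Var → Term → Term
  app  : Term → Term → Term
  get  : Term → Term
  set  : Term → Term → Term

data IsValue : Term → Set where
  v-reg  : ∀ r → IsValue (reg r)
  v-unit : IsValue unit
  v-lam  : ∀ x N → IsValue (lam x N)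

data EvCtx : Set where
  hole  : EvCtx
  appL  : EvCtx → Term → EvCtx
  appR  : (V : Term) → IsValue V → EvCtx → EvCtx
  getE  : EvCtx → EvCtx
  setL  : EvCtx → Term → EvCtx
  setR  : (V : Term) → IsValue V → EvCtx → EvCtx

plug : EvCtx → Term → Term
plug hole         N = N
plug (appL E M)   N = app (plug E N) M
plug (appR V _ E) N = app V (plug E N)
plug (getE E)     N = get (plug E N)
plug (setL E M)   N = set (plug E N) M
plug (setR V _ E) N = set V (plug E N)

data Redex : Term → Set where
  rd-beta : ∀ x N V → IsValue V → Redex (app (lam x N) V)
  rd-set  : ∀ r V → IsValue V → Redex (set (reg r) V)
  rd-get  : ∀ r → Redex (get (reg r))

Decomposes : Term → Set
Decomposes M = Σ EvCtx λ E → Σ Term λ Δ → Redex Δ × (M ≡ plug E Δ)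

data Ty : Set where
  𝟙    : Ty
  Reg  : Region → Ty → Ty
  _⇒_  : Ty → Ty → Ty

-- Region contexts r1:A1,...,rn:An (distinctness imposed in ⊢R_)
RCtx : Set
RCtx = List (Region × Ty)

-- Contexts x1:A1,...,xn:An ; extension Γ,x:A is  (x , A) ∷ Γ
Ctx : Set
Ctx = List (Var × Ty)

data _⊩_ (R : RCtx) : Ty → Set where
  wf-unit : R ⊩ 𝟙
  wf-arr  : ∀ {A B} → R ⊩ A → R ⊩ B → R ⊩ (A ⇒ B)
  wf-reg  : ∀ {r A} → (r , A) ∈ R → R ⊩ Reg r A

⊢R_ : RCtx → Set
⊢R R = Unique (map proj₁ R) × All (λ p → R ⊩ proj₂ p) R

_⊢Γ_ : RCtx → Ctx → Set
R ⊢Γ Γ = ⊢R R × All (λ p → R ⊩ proj₂ p) Γ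

-- x : A ∈ Γ  (the rightmost / most recent binding of x, i.e. usual shadowing)
data _∋_∶_ : Ctx → Var → Ty → Set where
  here  : ∀ {Γ x A} → ((x , A) ∷ Γ) ∋ x ∶ A
  there : ∀ {Γ x y A B} → x ≢ y → Γ ∋ x ∶ A → ((y , B) ∷ Γ) ∋ x ∶ A

data _︔_⊢ef_∶_ (R : RCtx) (Γ : Ctx) : Term → Ty → Set where
  t-var  : ∀ {x A} → R ⊢Γ Γ → Γ ∋ x ∶ A → R ︔ Γ ⊢ef var x ∶ A
  t-reg  : ∀ {r A} → R ⊢Γ Γ → (r , A) ∈ R → R ︔ Γ ⊢ef reg r ∶ Reg r A
  t-unit : R ⊢Γ Γ → R ︔ Γ ⊢ef unit ∶ 𝟙
  t-lam  : ∀ {x M A B} → R ︔ ((x , A) ∷ Γ) ⊢ef M ∶ B → R ︔ Γ ⊢ef lam x M ∶ (A ⇒ B)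
  t-app  : ∀ {M N A B} → R ︔ Γ ⊢ef M ∶ (A ⇒ B) → R ︔ Γ ⊢ef N ∶ A → R ︔ Γ ⊢ef app M N ∶ B
  t-get  : ∀ {M r A} → R ︔ Γ ⊢ef M ∶ Reg r A → R ︔ Γ ⊢ef get M ∶ A
  t-set  : ∀ {M N r A} → R ︔ Γ ⊢ef M ∶ Reg r A → R ︔ Γ ⊢ef N ∶ A → R ︔ Γ ⊢ef set M N ∶ 𝟙

ExactlyOne : Set → Set → Set
ExactlyOne P Q = (P × ¬ Q) ⊎ (Q × ¬ P)

module Submission where

-- The statement splits into two independent facts.
--   * Disjointness: a value is never of the form E[Δ].  Every redex is an
--     application, a get or a set, and filling any evaluation context with a
--     non-value again yields an application, get or set; values are none of
--     these.
--   * Progress: a closed well-typed term is a value or decomposes.  When a subterm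
--     decomposes, the decomposition is lifted through a single context frame
--     (contexts compose, and plugging respects composition); when all
--     immediate subterms are values, canonical forms (a value of arrow type is
--     a λ, a value of region type is a region) exhibit a redex at the root.

open import Defs
open import Data.List using ([])
open import Data.Product using (_,_; ∃-syntax)
open import Data.Sum using (_⊎_; inj₁; inj₂)
open import Relation.Binary.PropositionalEquality
  using (_≡_; refl; cong; sym)
open import Relation.Nullary using (¬_)

redex-not-value : ∀ {Δ} → Redex Δ → ¬ IsValue Δ
redex-not-value (rd-beta _ _ _ _) ()
redex-not-value (rd-set _ _ _)    ()
redex-not-value (rd-get _)        ()

plug-not-value : ∀ E {N} → ¬ IsValue N → ¬ IsValue (plug E N)
plug-not-value hole         ¬v = ¬v
plug-not-value (appL _ _)   _  ()
plug-not-value (appR _ _ _) _  ()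
plug-not-value (getE _)     _  ()
plug-not-value (setL _ _)   _  ()
plug-not-value (setR _ _ _) _  ()

value-not-decomposes : ∀ {M} → IsValue M → ¬ Decomposes M
value-not-decomposes v (E , Δ , rd , refl) = plug-not-value E (redex-not-value rd) v

_∘E_ : EvCtx → EvCtx → EvCtx
hole         ∘E E = E
appL F M     ∘E E = appL (F ∘E E) M
appR V v F   ∘E E = appR V v (F ∘E E)
getE F       ∘E E = getE (F ∘E E)
setL F M     ∘E E = setL (F ∘E E) M
setR V v F   ∘E E = setR V v (F ∘E E)

plug-∘E : ∀ F E N → plug (F ∘E E) N ≡ plug F (plug E N)
plug-∘E hole         E N = refl
plug-∘E (appL F M)   E N = cong (λ t → app t M) (plug-∘E F E N)
plug-∘E (appR V _ F) E N = cong (app V) (plug-∘E F E N)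
plug-∘E (getE F)     E N = cong get (plug-∘E F E N)
plug-∘E (setL F M)   E N = cong (λ t → set t M) (plug-∘E F E N)
plug-∘E (setR V _ F) E N = cong (set V) (plug-∘E F E N)

decomposes-under : ∀ F {M} → Decomposes M → Decomposes (plug F M)
decomposes-under F (E , Δ , rd , refl) = F ∘E E , Δ , rd , sym (plug-∘E F E Δ)

redex-decomposes : ∀ {Δ} → Redex Δ → Decomposes Δ
redex-decomposes rd = hole , _ , rd , refl

-- Canonical forms: values of arrow type are λs, values of region type are
-- regions (in any context, since variables are not values).
canonical-arrow : ∀ {R Γ V A B} → IsValue V → R ︔ Γ ⊢ef V ∶ (A ⇒ B) →
  ∃[ x ] ∃[ N ] V ≡ lam x N
canonical-arrow (v-lam x N) _ = x , N , refl

canonical-region : ∀ {R Γ V r A} → IsValue V → R ︔ Γ ⊢ef V ∶ Reg r A →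
  ∃[ s ] V ≡ reg s
canonical-region (v-reg s) _ = s , refl

progress : ∀ {R M A} → R ︔ [] ⊢ef M ∶ A → IsValue M ⊎ Decomposes M
progress (t-var _ ())
progress (t-reg {r = r} _ _)       = inj₁ (v-reg r)
progress (t-unit _)                = inj₁ v-unit
progress (t-lam {x = x} {M = M} _) = inj₁ (v-lam x M)
progress (t-app {N = N} d e) with progress d
... | inj₂ dM = inj₂ (decomposes-under (appL hole N) dM)
... | inj₁ vM with progress e
...   | inj₂ dN = inj₂ (decomposes-under (appR _ vM hole) dN)
...   | inj₁ vN with canonical-arrow vM d
...     | x , L , refl = inj₂ (redex-decomposes (rd-beta x L _ vN))
progress (t-get d) with progress d
... | inj₂ dM = inj₂ (decomposes-under (getE hole) dM)
... | inj₁ vM with canonical-region vM d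
...   | s , refl = inj₂ (redex-decomposes (rd-get s))
progress (t-set {N = N} d e) with progress d
... | inj₂ dM = inj₂ (decomposes-under (setL hole N) dM)
... | inj₁ vM with progress e
...   | inj₂ dN = inj₂ (decomposes-under (setR _ vM hole) dN)
...   | inj₁ vN with canonical-region vM d
...     | s , refl = inj₂ (redex-decomposes (rd-set s _ vN))

proposition1 : (R : RCtx) (M : Term) (A : Ty) → R ︔ [] ⊢ef M ∶ A →
    ExactlyOne (IsValue M) (Decomposes M)
proposition1 R M A d with progress d
... | inj₁ v  = inj₁ (v , value-not-decomposes v)
... | inj₂ dc = inj₂ (dc , λ v → value-not-decomposes v dc)
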